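{- Let $(G,b)$ be a yes-instance of ESCAD and let $S$ be a solution. Suppose that for a pair of vertices $u,v$ of $G$ and a positive integer $c$, a $(b,c)$-imbalance gadget $I_{u,v}$ is present in $G$ (i.e. $I_{u,v}$ is an induced subgraph of $G$). If $S$ is an inclusion-wise minimal solution, then $S$ contains no arc of $I_{u,v}$.
   Context: ESCAD: input a directed multigraph $G$ (parallel arcs allowed, no loops) and integer budget $b$; a solution is a set $S\subseteq E(G)$ with $|S|\le b$ such that every strongly connected component of $G-S$ is Eulerian (every vertex has equal in- and out-degree counting only arcs of $G-S$ with both endpoints in its strongly connected component). For vertices $u,v$ and positive integers $b,c$, a $(b,c)$-imbalance gadget $I_{u,v}$ consists of a path on vertices $u=w_0,w_1,\dots,w_b,w_{b+1}=v$, where $w_1,\dots,w_b$ are new vertices, and for every $i\in\{0,\dots,b\}$ there are $b+1+c$ parallel forward arcs $(w_i,w_{i+1})$ and $b+1$ parallel backward arcs $(w_{i+1},w_i)$. -}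

module Defs where

open import Data.Nat using (ℕ; zero; suc; _+_; _≤_; _<_)
open import Data.Bool using (Bool; true; false; _∧_; _∨_; not; if_then_else_)
open import Data.Fin using (Fin; zero; suc; toℕ; fromℕ; inject₁; _≟_)
open import Data.Fin.Subset using (Subset; inside; outside; _⊂_; _∉_; ∣_∣)
open import Data.Vec using (lookup)
open import Data.Product using (Σ; _×_; _,_)
open import Data.Sum using (_⊎_)
open import Relation.Nullary using (¬_)
open import Relation.Nullary.Decidable using (⌊_⌋)
open import Relation.Binary.PropositionalEquality using (_≡_; _≢_)
open import Function.Definitions using (Injective)

-- A directed multigraph without loops: vertices Fin n, arcs Fin m,
-- each arc e goes from src e to tgt e (parallel arcs allowed).
record Multidigraph (n m : ℕ) : Set where
  field
    src : Fin m → Fin n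
    tgt : Fin m → Fin n
    loopless : ∀ e → src e ≢ tgt e

open Multidigraph public

countB : ∀ {m} → (Fin m → Bool) → ℕ
countB {zero}  p = 0
countB {suc m} p = (if p zero then 1 else 0) + countB (λ i → p (suc i))

anyB : ∀ {m} → (Fin m → Bool) → Bool
anyB {zero}  p = false
anyB {suc m} p = p zero ∨ anyB (λ i → p (suc i))

module _ {n m : ℕ} (G : Multidigraph n m) (S : Subset m) where

  kept : Fin m → Bool
  kept e = not (lookup S e)

  reachWithin : ℕ → Fin n → Fin n → Bool
  reachWithin zero x y = ⌊ x ≟ y ⌋
  reachWithin (suc k) x y =
    reachWithin k x y ∨
    anyB (λ e → kept e ∧ ⌊ src G e ≟ x ⌋ ∧ reachWithin k (tgt G e) y)

  -- reachability in G - S (walks of length ≤ n suffice)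
  reaches : Fin n → Fin n → Bool
  reaches = reachWithin n

  sameSCC : Fin n → Fin n → Bool
  sameSCC x y = reaches x y ∧ reaches y x

  outdegSCC : Fin n → ℕ
  outdegSCC x = countB (λ e → kept e ∧ ⌊ src G e ≟ x ⌋ ∧ sameSCC x (tgt G e))

  indegSCC : Fin n → ℕ
  indegSCC x = countB (λ e → kept e ∧ ⌊ tgt G e ≟ x ⌋ ∧ sameSCC (src G e) x)

  AllSCCsEulerian : Set
  AllSCCsEulerian = ∀ x → outdegSCC x ≡ indegSCC x

IsSolution : ∀ {n m} → Multidigraph n m → ℕ → Subset m → Set
IsSolution G b S = ∣ S ∣ ≤ b × AllSCCsEulerian G S

IsMinimalSolution : ∀ {n m} → Multidigraph n m → ℕ → Subset m → Set
IsMinimalSolution G b S =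
  IsSolution G b S × (∀ S' → S' ⊂ S → ¬ IsSolution G b S')

arcCount : ∀ {n m} → Multidigraph n m → Fin n → Fin n → ℕ
arcCount G x y = countB (λ e → ⌊ src G e ≟ x ⌋ ∧ ⌊ tgt G e ≟ y ⌋)

module _ {n m : ℕ} (G : Multidigraph n m) (b : ℕ) (w : Fin (suc (suc b)) → Fin n) where

  IsGadgetArc : Fin m → Set
  IsGadgetArc e = Σ (Fin (suc b)) λ i →
      (src G e ≡ w (inject₁ i) × tgt G e ≡ w (suc i))
    ⊎ (src G e ≡ w (suc i) × tgt G e ≡ w (inject₁ i))

  Internal : Fin (suc (suc b)) → Set
  Internal j = 0 < toℕ j × toℕ j ≤ b

GadgetPresent : ∀ {n m} → Multidigraph n m → (b c : ℕ) → Fin n → Fin n →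
                (Fin (suc (suc b)) → Fin n) → Set
GadgetPresent {n} {m} G b c u v w =
    Injective _≡_ _≡_ w
  × w zero ≡ u
  × w (fromℕ (suc b)) ≡ v
  × (∀ (i : Fin (suc b)) →
        arcCount G (w (inject₁ i)) (w (suc i)) ≡ b + 1 + c
      × arcCount G (w (suc i)) (w (inject₁ i)) ≡ b + 1)
  × (∀ (e : Fin m) (j k : Fin (suc (suc b))) →
        src G e ≡ w j → tgt G e ≡ w k → IsGadgetArc G b w e)
  × (∀ (e : Fin m) (j : Fin (suc (suc b))) → Internal G b w j →
        (src G e ≡ w j ⊎ tgt G e ≡ w j) → IsGadgetArc G b w e)

-- A solution deletes at most b arcs, while consecutive path vertices of the gadget are joined
-- by more than b arcs in each direction; so some arc survives in each direction and the whole
-- path lies in one strongly connected component of G − S.  An inner vertex has no other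
-- neighbours, so its Eulerian condition says that the number of deleted forward arcs minus
-- the number of deleted backward arcs is the same on the two pairs around it: this difference
-- is constant along the path.  As b deletions cannot touch all b + 1 pairs, it is zero.
-- Hence a deleted gadget arc x → y comes with a deleted arc y → x, and restoring this 2-cycle
-- keeps every component (surviving parallel copies already connect x and y) and keeps it
-- Eulerian, contradicting minimality.

module Submission where

open import Data.Bool using (Bool; true; false; _∧_; _∨_; not; if_then_else_; T)
open import Data.Bool.Properties
  using (∨-zeroʳ; ∨-identityʳ; ∧-zeroʳ; ∧-identityʳ; ∧-comm; ∧-distribʳ-∨; ¬-not)
open import Data.Empty using (⊥; ⊥-elim)
open import Data.Fin using (Fin; zero; suc; toℕ; inject₁; _≟_)
open import Data.Fin.Properties using (inject₁-injective; suc-injective; toℕ-inject₁; toℕ<n)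
open import Data.Fin.Subset using (Subset; _∈_; _∉_; _⊆_; _∪_; _─_; ⁅_⁆; ∣_∣) renaming (⊥ to ∅)
open import Data.Fin.Subset.Properties
  using (x∈⁅x⁆; x∈⁅y⁆⇒x≡y; x∈p∪q⁺; x∈p∪q⁻; x∈p∩q⁺; p∩q≢∅⇒p─q⊂p; ∣p─q∣≤∣p∣)
open import Data.Nat using (ℕ; zero; suc; _+_; _≤_; _<_; z≤n; s≤s; z<s)
open import Data.Nat.Properties
  using (+-comm; +-suc; +-identityʳ; +-cancelˡ-≡; +-cancelʳ-≡; +-monoʳ-≤; ≤-trans; ≤-reflexive;
         ≤-<-trans; <-≤-trans; ≤⇒≯; m≤n+m; m≤m+n; m<m+n; m≤n⇒m≤1+n; m≢1+n+m; n≤0⇒n≡0;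
         +-0-monoid; +-commutativeSemigroup; module ≤-Reasoning)
open import Data.Product using (∃; _×_; _,_; proj₁; proj₂)
open import Data.Sum using (_⊎_; inj₁; inj₂; [_,_])
open import Data.Unit using (tt)
open import Data.Vec using ([]; _∷_; lookup)
open import Data.Vec.Properties using (lookup-zipWith; lookup-replicate; []=⇒lookup; lookup⇒[]=)
open import Function using (_∘_)
open import Function.Definitions using (Injective)
open import Relation.Nullary using (contradiction)
open import Relation.Nullary.Decidable using (⌊_⌋; yes; no; toWitness)
open import Relation.Binary.PropositionalEquality
  using (_≡_; _≢_; refl; sym; trans; cong; cong₂; subst; _≗_; ≡-≟-identity; module ≡-Reasoning)

open import Algebra.Properties.CommutativeSemigroup +-commutativeSemigroup using (interchange)
open import Algebra.Properties.Monoid.Sum +-0-monoid using (sum)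

open import Defs

-- Booleans and counting

indicator : Bool → ℕ
indicator b = if b then 1 else 0

∧-true : ∀ {a b} → a ∧ b ≡ true → a ≡ true × b ≡ true
∧-true {true} b≡true = refl , b≡true

∨-true : ∀ {a b} → a ∨ b ≡ true → a ≡ true ⊎ b ≡ true
∨-true {true}  _      = inj₁ refl
∨-true {false} b≡true = inj₂ b≡true

∨-trueʳ : ∀ a {b} → b ≡ true → a ∨ b ≡ true
∨-trueʳ a refl = ∨-zeroʳ a

true-⇔⇒≡ : ∀ {a b} → (a ≡ true → b ≡ true) → (b ≡ true → a ≡ true) → a ≡ b
true-⇔⇒≡ {true}  {true}  _ _ = refl
true-⇔⇒≡ {true}  {false} a⇒b _ = sym (a⇒b refl)
true-⇔⇒≡ {false} {true}  _ b⇒a = b⇒a refl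
true-⇔⇒≡ {false} {false} _ _ = refl

≟-true⇒≡ : ∀ {k} {i j : Fin k} → ⌊ i ≟ j ⌋ ≡ true → i ≡ j
≟-true⇒≡ i≟j = toWitness (subst T (sym i≟j) tt)

≡⇒≟-true : ∀ {k} {i j : Fin k} → i ≡ j → ⌊ i ≟ j ⌋ ≡ true
≡⇒≟-true i≡j = cong ⌊_⌋ (≡-≟-identity _≟_ i≡j)

countB-cong : ∀ {m} {p q : Fin m → Bool} → p ≗ q → countB p ≡ countB q
countB-cong {zero}  p≗q = refl
countB-cong {suc m} p≗q = cong₂ _+_ (cong indicator (p≗q zero)) (countB-cong (p≗q ∘ suc))

countB-false : ∀ {m} {p : Fin m → Bool} → (∀ e → p e ≡ false) → countB p ≡ 0
countB-false {zero}  _   = refl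
countB-false {suc m} p≡f rewrite p≡f zero = countB-false (p≡f ∘ suc)

countB-∨ : ∀ {m} (p q : Fin m → Bool) → (∀ e → p e ∧ q e ≡ false) →
           countB (λ e → p e ∨ q e) ≡ countB p + countB q
countB-∨ {zero}  p q disjoint = refl
countB-∨ {suc m} p q disjoint with p zero | q zero | disjoint zero
                                   | countB-∨ (p ∘ suc) (q ∘ suc) (disjoint ∘ suc)
... | true  | true  | () | _
... | true  | false | _  | ih = cong suc ih
... | false | true  | _  | ih = trans (cong suc ih) (sym (+-suc _ _))
... | false | false | _  | ih = ih

countB-split : ∀ {m} (p q : Fin m → Bool) →
               countB p ≡ countB (λ e → p e ∧ q e) + countB (λ e → p e ∧ not (q e))
countB-split {zero}  p q = refl
countB-split {suc m} p q with p zero | q zero | countB-split (p ∘ suc) (q ∘ suc)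
... | true  | true  | ih = cong suc ih
... | true  | false | ih = trans (cong suc ih) (sym (+-suc _ _))
... | false | _     | ih = ih

countB-mono : ∀ {m} {p q : Fin m → Bool} → (∀ e → p e ≡ true → q e ≡ true) → countB p ≤ countB q
countB-mono {zero}          p⇒q = z≤n
countB-mono {suc m} {p} {q} p⇒q with p zero | q zero | p⇒q zero
                                    | countB-mono {p = p ∘ suc} {q ∘ suc} (p⇒q ∘ suc)
... | true  | true  | _    | ih = s≤s ih
... | true  | false | p⇒q₀ | _  = contradiction (p⇒q₀ refl) λ ()
... | false | true  | _    | ih = m≤n⇒m≤1+n ih
... | false | false | _    | ih = ih

countB-pos : ∀ {m} (p : Fin m → Bool) {a} → p a ≡ true → 0 < countB p
countB-pos p {zero}  pa rewrite pa = z<s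
countB-pos p {suc a} pa = <-≤-trans (countB-pos (p ∘ suc) pa) (m≤n+m _ _)

countB-witness : ∀ {m} (p : Fin m → Bool) → 0 < countB p → ∃ λ a → p a ≡ true
countB-witness {suc m} p 0<count with p zero in pa
... | true  = zero , pa
... | false with countB-witness (p ∘ suc) 0<count
...   | a , pa′ = suc a , pa′

countB-⁅⁆∧ : ∀ {m} (a : Fin m) (g : Fin m → Bool) →
             countB (λ e → lookup ⁅ a ⁆ e ∧ g e) ≡ indicator (g a)
countB-⁅⁆∧ zero    g = trans (cong (indicator (g zero) +_) (countB-false outside))
                             (+-identityʳ _)
  where
  outside : ∀ e → lookup ∅ e ∧ g (suc e) ≡ false
  outside e rewrite lookup-replicate e false = refl
countB-⁅⁆∧ (suc a) g = countB-⁅⁆∧ a (g ∘ suc)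

countB-⁅⁆∪⁅⁆∧ : ∀ {m} {a b : Fin m} → a ≢ b → (g : Fin m → Bool) →
                countB (λ e → lookup (⁅ a ⁆ ∪ ⁅ b ⁆) e ∧ g e) ≡ indicator (g a) + indicator (g b)
countB-⁅⁆∪⁅⁆∧ {a = a} {b} a≢b g = begin
  countB (λ e → lookup (⁅ a ⁆ ∪ ⁅ b ⁆) e ∧ g e)
    ≡⟨ countB-cong (λ e → trans (cong (_∧ g e) (lookup-zipWith _∨_ e ⁅ a ⁆ ⁅ b ⁆))
                                (∧-distribʳ-∨ (g e) (lookup ⁅ a ⁆ e) (lookup ⁅ b ⁆ e))) ⟩
  countB (λ e → (lookup ⁅ a ⁆ e ∧ g e) ∨ (lookup ⁅ b ⁆ e ∧ g e))
    ≡⟨ countB-∨ _ _ (λ e → ¬-not (not-both e)) ⟩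
  countB (λ e → lookup ⁅ a ⁆ e ∧ g e) + countB (λ e → lookup ⁅ b ⁆ e ∧ g e)
    ≡⟨ cong₂ _+_ (countB-⁅⁆∧ a g) (countB-⁅⁆∧ b g) ⟩
  indicator (g a) + indicator (g b) ∎
  where
  open ≡-Reasoning
  not-both : ∀ e → (lookup ⁅ a ⁆ e ∧ g e) ∧ (lookup ⁅ b ⁆ e ∧ g e) ≢ true
  not-both e both with ∧-true both
  ... | ea , eb = a≢b (trans (sym (x∈⁅y⁆⇒x≡y a (lookup⇒[]= e ⁅ a ⁆ (proj₁ (∧-true ea)))))
                             (x∈⁅y⁆⇒x≡y b (lookup⇒[]= e ⁅ b ⁆ (proj₁ (∧-true eb)))))

-- Stated for arbitrary endpoint maps a, b so that it serves out-degrees (a, b = src, tgt)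
-- and in-degrees (a, b = tgt, src).
countB-between : ∀ {n m} {x y z : Fin n} → y ≢ z →
                 (K : Fin m → Bool) (a b : Fin m → Fin n) (C : Fin n → Bool) →
                 C y ≡ true → C z ≡ true → (∀ e → a e ≡ x → b e ≡ y ⊎ b e ≡ z) →
                 countB (λ e → K e ∧ ⌊ a e ≟ x ⌋ ∧ C (b e))
                 ≡ countB (λ e → (⌊ a e ≟ x ⌋ ∧ ⌊ b e ≟ y ⌋) ∧ K e)
                   + countB (λ e → (⌊ a e ≟ x ⌋ ∧ ⌊ b e ≟ z ⌋) ∧ K e)
countB-between {x = x} {y} {z} y≢z K a b C Cy Cz ends =
  trans (countB-cong split) (countB-∨ _ _ disjoint)
  where
  split : ∀ e → K e ∧ ⌊ a e ≟ x ⌋ ∧ C (b e)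
                ≡ (⌊ a e ≟ x ⌋ ∧ ⌊ b e ≟ y ⌋) ∧ K e
                  ∨ (⌊ a e ≟ x ⌋ ∧ ⌊ b e ≟ z ⌋) ∧ K e
  split e with a e ≟ x | b e ≟ y | b e ≟ z
  ... | no _     | _        | _        = ∧-zeroʳ (K e)
  ... | yes _    | yes refl | yes refl = contradiction refl y≢z
  ... | yes _    | yes refl | no _     rewrite Cy =
    trans (∧-identityʳ (K e)) (sym (∨-identityʳ (K e)))
  ... | yes _    | no _     | yes refl rewrite Cz = ∧-identityʳ (K e)
  ... | yes a≡x  | no b≢y   | no b≢z   = ⊥-elim ([ b≢y , b≢z ] (ends e a≡x))
  disjoint : ∀ e → ((⌊ a e ≟ x ⌋ ∧ ⌊ b e ≟ y ⌋) ∧ K e)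
                   ∧ ((⌊ a e ≟ x ⌋ ∧ ⌊ b e ≟ z ⌋) ∧ K e) ≡ false
  disjoint e with a e ≟ x | b e ≟ y | b e ≟ z
  ... | no _  | _        | _        = refl
  ... | yes _ | no _     | _        = refl
  ... | yes _ | yes refl | yes refl = contradiction refl y≢z
  ... | yes _ | yes _    | no _     = ∧-zeroʳ (K e)

∣∣≡countB : ∀ {m} (S : Subset m) → ∣ S ∣ ≡ countB (lookup S)
∣∣≡countB []          = refl
∣∣≡countB (true ∷ S)  = cong suc (∣∣≡countB S)
∣∣≡countB (false ∷ S) = ∣∣≡countB S

sum-countB-≤ : ∀ {m} k (P : Fin k → Fin m → Bool) (Q : Fin m → Bool) →
               (∀ i e → P i e ≡ true → Q e ≡ true) →
               (∀ i j e → P i e ≡ true → P j e ≡ true → i ≡ j) →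
               sum (λ i → countB (P i)) ≤ countB Q
sum-countB-≤ zero    P Q P⊆Q disjoint = z≤n
sum-countB-≤ (suc k) P Q P⊆Q disjoint = begin
  countB (P zero) + sum (λ i → countB (P (suc i)))
    ≤⟨ +-monoʳ-≤ (countB (P zero)) (sum-countB-≤ k (P ∘ suc) Q-P₀ rest⊆Q-P₀
                                      (λ i j e p q → suc-injective (disjoint _ _ e p q))) ⟩
  countB (P zero) + countB Q-P₀
    ≡⟨ cong (_+ countB Q-P₀) (countB-cong P₀⊆Q) ⟩
  countB (λ e → Q e ∧ P zero e) + countB Q-P₀
    ≡⟨ countB-split Q (P zero) ⟨
  countB Q ∎
  where
  open ≤-Reasoning
  Q-P₀ : Fin _ → Bool
  Q-P₀ e = Q e ∧ not (P zero e)
  rest⊆Q-P₀ : ∀ i e → P (suc i) e ≡ true → Q-P₀ e ≡ true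
  rest⊆Q-P₀ i e p with P zero e in p₀
  ... | true  = contradiction (disjoint zero (suc i) e p₀ p) λ ()
  ... | false = trans (∧-identityʳ (Q e)) (P⊆Q (suc i) e p)
  P₀⊆Q : ∀ e → P zero e ≡ Q e ∧ P zero e
  P₀⊆Q e with P zero e in p₀
  ... | true  = sym (trans (∧-identityʳ (Q e)) (P⊆Q zero e p₀))
  ... | false = sym (∧-zeroʳ (Q e))

sum≤⇒∃≡0 : ∀ k (f : Fin (suc k) → ℕ) → sum f ≤ k → ∃ λ i → f i ≡ 0
sum≤⇒∃≡0 k f sum≤k with f zero in f₀
... | zero = zero , f₀
sum≤⇒∃≡0 (suc k) f (s≤s sum≤k) | suc x with sum≤⇒∃≡0 k (f ∘ suc) (≤-trans (m≤n+m _ x) sum≤k)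
... | i , fi≡0 = suc i , fi≡0

anyB-intro : ∀ {m} (p : Fin m → Bool) a → p a ≡ true → anyB p ≡ true
anyB-intro p zero    pa = cong (_∨ anyB (p ∘ suc)) pa
anyB-intro p (suc a) pa = ∨-trueʳ (p zero) (anyB-intro (p ∘ suc) a pa)

anyB-witness : ∀ {m} (p : Fin m → Bool) → anyB p ≡ true → ∃ λ a → p a ≡ true
anyB-witness {suc m} p any with ∨-true {p zero} any
... | inj₁ p₀ = zero , p₀
... | inj₂ rest with anyB-witness (p ∘ suc) rest
...   | a , pa = suc a , pa

-- Arithmetic on finite sequences

m≤n∧n<m+o⇒0<o : ∀ {m n} o → m ≤ n → n < m + o → 0 < o
m≤n∧n<m+o⇒0<o zero    m≤n n<m+0 = contradiction (subst (_ <_) (+-identityʳ _) n<m+0) (≤⇒≯ m≤n)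
m≤n∧n<m+o⇒0<o (suc o) _   _     = z<s

balance-of-complements : ∀ {p q p′ q′ k l k′ l′ A B : ℕ} →
                         p + k ≡ B → q + l ≡ A → p′ + k′ ≡ A → q′ + l′ ≡ B → k + l ≡ k′ + l′ →
                         p + q ≡ p′ + q′
balance-of-complements {p} {q} {p′} {q′} {k} {l} {k′} {l′} {A} {B} pk ql pk′ ql′ kl =
  +-cancelʳ-≡ (k + l) (p + q) (p′ + q′) (begin
    (p + q) + (k + l)      ≡⟨ interchange p q k l ⟩
    (p + k) + (q + l)      ≡⟨ cong₂ _+_ pk ql ⟩
    B + A                  ≡⟨ +-comm B A ⟩
    A + B                  ≡⟨ cong₂ _+_ pk′ ql′ ⟨
    (p′ + k′) + (q′ + l′)  ≡⟨ interchange p′ k′ q′ l′ ⟩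
    (p′ + q′) + (k′ + l′)  ≡⟨ cong ((p′ + q′) +_) kl ⟨
    (p′ + q′) + (k + l)    ∎)
  where open ≡-Reasoning

-- f (i + 1) − g (i + 1) ≡ f i − g i, written without truncated subtraction.
ConstantDifference : ∀ {k} → (Fin (suc k) → ℕ) → (Fin (suc k) → ℕ) → Set
ConstantDifference f g = ∀ i → g (inject₁ i) + f (suc i) ≡ f (inject₁ i) + g (suc i)

agree-at-zero : ∀ {k} (f g : Fin (suc k) → ℕ) → ConstantDifference f g →
                ∀ j → f j ≡ g j → f zero ≡ g zero
agree-at-zero         f g const zero     f≡g = f≡g
agree-at-zero {zero}  f g const (suc ())
agree-at-zero {suc k} f g const (suc j) f≡g =
  sym (+-cancelʳ-≡ (f (suc zero)) (g zero) (f zero)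
        (trans (const zero) (cong (f zero +_) (sym f₁≡g₁))))
  where
  f₁≡g₁ : f (suc zero) ≡ g (suc zero)
  f₁≡g₁ = agree-at-zero (f ∘ suc) (g ∘ suc) (const ∘ suc) j f≡g

agree-from-zero : ∀ {k} (f g : Fin (suc k) → ℕ) → ConstantDifference f g →
                  f zero ≡ g zero → ∀ j → f j ≡ g j
agree-from-zero         f g const f₀≡g₀ zero     = f₀≡g₀
agree-from-zero {zero}  f g const f₀≡g₀ (suc ())
agree-from-zero {suc k} f g const f₀≡g₀ (suc j) =
  agree-from-zero (f ∘ suc) (g ∘ suc) (const ∘ suc) f₁≡g₁ j
  where
  f₁≡g₁ : f (suc zero) ≡ g (suc zero)
  f₁≡g₁ = +-cancelˡ-≡ (g zero) (f (suc zero)) (g (suc zero))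
            (trans (const zero) (cong (_+ g (suc zero)) f₀≡g₀))

agree-everywhere : ∀ {k} (f g : Fin (suc k) → ℕ) → ConstantDifference f g →
                   ∀ j₀ → f j₀ ≡ g j₀ → ∀ j → f j ≡ g j
agree-everywhere f g const j₀ agree = agree-from-zero f g const (agree-at-zero f g const j₀ agree)

no-crossing : ∀ {k} {i j : Fin (suc k)} → inject₁ i ≡ suc j → suc i ≡ inject₁ j → ⊥
no-crossing {i = i} {j} i≡1+j 1+i≡j = m≢1+n+m (toℕ j) (begin
  toℕ j                     ≡⟨ toℕ-inject₁ j ⟨
  toℕ (inject₁ j)           ≡⟨ cong toℕ 1+i≡j ⟨
  suc (toℕ i)               ≡⟨ cong suc (toℕ-inject₁ i) ⟨
  suc (toℕ (inject₁ i))     ≡⟨ cong (suc ∘ toℕ) i≡1+j ⟩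
  suc (suc (toℕ j))         ∎)
  where open ≡-Reasoning

-- Arcs, reachability and degrees in G − S

module _ {n m : ℕ} (G : Multidigraph n m) where

  isArc : Fin n → Fin n → Fin m → Bool
  isArc x y e = ⌊ src G e ≟ x ⌋ ∧ ⌊ tgt G e ≟ y ⌋

  isArc-true : ∀ {x y e} → isArc x y e ≡ true → src G e ≡ x × tgt G e ≡ y
  isArc-true isArc-e with ∧-true isArc-e
  ... | src≟x , tgt≟y = ≟-true⇒≡ src≟x , ≟-true⇒≡ tgt≟y

  isArc-intro : ∀ {x y} e → src G e ≡ x → tgt G e ≡ y → isArc x y e ≡ true
  isArc-intro e src≡x tgt≡y = cong₂ _∧_ (≡⇒≟-true src≡x) (≡⇒≟-true tgt≡y)

  module _ (S : Subset m) where

    deletedArcs keptArcs : Fin n → Fin n → ℕ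
    deletedArcs x y = countB (λ e → isArc x y e ∧ lookup S e)
    keptArcs    x y = countB (λ e → isArc x y e ∧ kept G S e)

    KeptArc : Fin n → Fin n → Set
    KeptArc x y = ∃ λ e → kept G S e ≡ true × src G e ≡ x × tgt G e ≡ y

    deleted+kept≡arcCount : ∀ x y → deletedArcs x y + keptArcs x y ≡ arcCount G x y
    deleted+kept≡arcCount x y = sym (countB-split (isArc x y) (lookup S))

    deletedArcs≤∣S∣ : ∀ x y → deletedArcs x y ≤ ∣ S ∣
    deletedArcs≤∣S∣ x y = ≤-trans (countB-mono (λ e → proj₂ ∘ ∧-true {isArc x y e}))
                                  (≤-reflexive (sym (∣∣≡countB S)))

    ∣S∣<arcCount⇒0<keptArcs : ∀ {x y} → ∣ S ∣ < arcCount G x y → 0 < keptArcs x y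
    ∣S∣<arcCount⇒0<keptArcs {x} {y} ∣S∣<count =
      m≤n∧n<m+o⇒0<o (keptArcs x y) (deletedArcs≤∣S∣ x y)
                    (subst (∣ S ∣ <_) (sym (deleted+kept≡arcCount x y)) ∣S∣<count)

    ∣S∣<arcCount⇒KeptArc : ∀ {x y} → ∣ S ∣ < arcCount G x y → KeptArc x y
    ∣S∣<arcCount⇒KeptArc ∣S∣<count with countB-witness _ (∣S∣<arcCount⇒0<keptArcs ∣S∣<count)
    ... | e , isArc∧kept with ∧-true isArc∧kept
    ...   | isArc-e , kept-e = e , kept-e , isArc-true isArc-e

    Covers : Subset m → Set
    Covers S′ = ∀ e → kept G S′ e ≡ true → KeptArc (src G e) (tgt G e)

    private
      firstArc : ℕ → Fin n → Fin n → Fin m → Bool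
      firstArc k x y e = kept G S e ∧ ⌊ src G e ≟ x ⌋ ∧ reachWithin G S k (tgt G e) y

    reachWithin-weaken : ∀ k x y → reachWithin G S k x y ≡ true → reachWithin G S (suc k) x y ≡ true
    reachWithin-weaken k x y = cong (_∨ anyB (firstArc k x y))

    reachWithin-step : ∀ k x y {e} → kept G S e ≡ true → src G e ≡ x →
                       reachWithin G S k (tgt G e) y ≡ true → reachWithin G S (suc k) x y ≡ true
    reachWithin-step k x y {e} kept-e src≡x reach =
      ∨-trueʳ (reachWithin G S k x y)
        (anyB-intro (firstArc k x y) e (cong₂ _∧_ kept-e (cong₂ _∧_ (≡⇒≟-true src≡x) reach)))

    reachWithin-suc⁻ : ∀ k x y → reachWithin G S (suc k) x y ≡ true →
                       reachWithin G S k x y ≡ true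
                       ⊎ ∃ λ e → kept G S e ≡ true × src G e ≡ x × reachWithin G S k (tgt G e) y ≡ true
    reachWithin-suc⁻ k x y reach with ∨-true {reachWithin G S k x y} reach
    ... | inj₁ short = inj₁ short
    ... | inj₂ step with anyB-witness (firstArc k x y) step
    ...   | e , first with ∧-true first
    ...     | kept-e , src∧reach with ∧-true src∧reach
    ...       | src≟x , reach′ = inj₂ (e , kept-e , ≟-true⇒≡ src≟x , reach′)

    reachWithin-refl : ∀ k x → reachWithin G S k x x ≡ true
    reachWithin-refl zero    x = ≡⇒≟-true refl
    reachWithin-refl (suc k) x = reachWithin-weaken k x x (reachWithin-refl k x)

    sameSCC-sym : ∀ x y → sameSCC G S x y ≡ sameSCC G S y x
    sameSCC-sym x y = ∧-comm (reaches G S x y) (reaches G S y x)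

keptArc⇒reaches : ∀ {n m} (G : Multidigraph n m) (S : Subset m) {x y} →
                  KeptArc G S x y → reaches G S x y ≡ true
keptArc⇒reaches {zero}  G S {()}
keptArc⇒reaches {suc n} G S {x} {y} (e , kept-e , src≡x , refl) =
  reachWithin-step G S n x y kept-e src≡x (reachWithin-refl G S n y)

keptArcs⇒sameSCC : ∀ {n m} (G : Multidigraph n m) (S : Subset m) {x y} →
                   KeptArc G S x y → KeptArc G S y x → sameSCC G S x y ≡ true
keptArcs⇒sameSCC G S xy yx = cong₂ _∧_ (keptArc⇒reaches G S xy) (keptArc⇒reaches G S yx)

reachWithin-transfer : ∀ {n m} (G : Multidigraph n m) {S S′ : Subset m} → Covers G S S′ →
                       ∀ k x y → reachWithin G S′ k x y ≡ true → reachWithin G S k x y ≡ true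
reachWithin-transfer G         covers zero    x y reach = reach
reachWithin-transfer G {S} {S′} covers (suc k) x y reach with reachWithin-suc⁻ G S′ k x y reach
... | inj₁ short = reachWithin-weaken G S k x y (reachWithin-transfer G covers k x y short)
... | inj₂ (e , kept-e , refl , reach′) with covers e kept-e
...   | e′ , kept-e′ , src≡ , tgt≡ =
  reachWithin-step G S k x y kept-e′ src≡
    (subst (λ t → reachWithin G S k t y ≡ true) (sym tgt≡)
           (reachWithin-transfer G covers k (tgt G e) y reach′))

sameSCC-transfer : ∀ {n m} (G : Multidigraph n m) {S S′ : Subset m} →
                   Covers G S S′ → Covers G S′ S → ∀ x y → sameSCC G S′ x y ≡ sameSCC G S x y
sameSCC-transfer {n} G {S} {S′} covers covers′ x y = cong₂ _∧_ (reaches-≡ x y) (reaches-≡ y x)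
  where
  reaches-≡ : ∀ x y → reaches G S′ x y ≡ reaches G S x y
  reaches-≡ x y = true-⇔⇒≡ (reachWithin-transfer G covers n x y)
                           (reachWithin-transfer G covers′ n x y)

module _ {n m : ℕ} (G : Multidigraph n m) (S : Subset m) {x y z : Fin n} (y≢z : y ≢ z)
         (x~y : sameSCC G S x y ≡ true) (x~z : sameSCC G S x z ≡ true) where

  outdegSCC-between : (∀ e → src G e ≡ x → tgt G e ≡ y ⊎ tgt G e ≡ z) →
                      outdegSCC G S x ≡ keptArcs G S x y + keptArcs G S x z
  outdegSCC-between = countB-between y≢z (kept G S) (src G) (tgt G) (sameSCC G S x) x~y x~z

  indegSCC-between : (∀ e → tgt G e ≡ x → src G e ≡ y ⊎ src G e ≡ z) →
                     indegSCC G S x ≡ keptArcs G S y x + keptArcs G S z x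
  indegSCC-between ends = begin
    indegSCC G S x
      ≡⟨ countB-between y≢z (kept G S) (tgt G) (src G) (λ s → sameSCC G S s x)
                        (trans (sameSCC-sym G S y x) x~y) (trans (sameSCC-sym G S z x) x~z) ends ⟩
    countB (λ e → (⌊ tgt G e ≟ x ⌋ ∧ ⌊ src G e ≟ y ⌋) ∧ kept G S e)
      + countB (λ e → (⌊ tgt G e ≟ x ⌋ ∧ ⌊ src G e ≟ z ⌋) ∧ kept G S e)
      ≡⟨ cong₂ _+_ (countB-cong (λ e → cong (_∧ kept G S e) (∧-comm ⌊ tgt G e ≟ x ⌋ _)))
                   (countB-cong (λ e → cong (_∧ kept G S e) (∧-comm ⌊ tgt G e ≟ x ⌋ _))) ⟩
    keptArcs G S y x + keptArcs G S z x ∎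
    where open ≡-Reasoning

  kept-out≡kept-in : AllSCCsEulerian G S →
                     (∀ e → src G e ≡ x → tgt G e ≡ y ⊎ tgt G e ≡ z) →
                     (∀ e → tgt G e ≡ x → src G e ≡ y ⊎ src G e ≡ z) →
                     keptArcs G S x y + keptArcs G S x z ≡ keptArcs G S y x + keptArcs G S z x
  kept-out≡kept-in eulerian out-ends in-ends =
    trans (sym (outdegSCC-between out-ends)) (trans (eulerian x) (indegSCC-between in-ends))

-- Putting deleted arcs back

not-lookup-─ : ∀ {m} (S X : Subset m) e → not (lookup (S ─ X) e) ≡ not (lookup S e) ∨ lookup X e
not-lookup-─ (s ∷ S) (true  ∷ X) zero    = sym (∨-zeroʳ (not s))
not-lookup-─ (s ∷ S) (false ∷ X) zero    = sym (∨-identityʳ (not s))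
not-lookup-─ (s ∷ S) (x ∷ X)     (suc e) = not-lookup-─ S X e

module _ {n m : ℕ} (G : Multidigraph n m) where

  Shadowed : Subset m → Subset m → Set
  Shadowed S X = ∀ {e} → e ∈ X →
                 KeptArc G S (src G e) (tgt G e) × KeptArc G S (tgt G e) (src G e)

  Balanced : Subset m → Set
  Balanced X = ∀ x → countB (λ e → lookup X e ∧ ⌊ src G e ≟ x ⌋)
                     ≡ countB (λ e → lookup X e ∧ ⌊ tgt G e ≟ x ⌋)

  module _ {S X : Subset m} (X⊆S : X ⊆ S) (shadowed : Shadowed S X) where

    private
      X-deleted : ∀ {e} → lookup X e ≡ true → kept G S e ≡ false
      X-deleted {e} e∈X = cong not ([]=⇒lookup (X⊆S (lookup⇒[]= e X e∈X)))

      X-within-SCC : ∀ {e} → lookup X e ≡ true → sameSCC G S (src G e) (tgt G e) ≡ true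
      X-within-SCC {e} e∈X with shadowed (lookup⇒[]= e X e∈X)
      ... | forward , backward = keptArcs⇒sameSCC G S forward backward

      sameSCC-─ : ∀ x y → sameSCC G (S ─ X) x y ≡ sameSCC G S x y
      sameSCC-─ = sameSCC-transfer G covers covers′
        where
        covers : Covers G S (S ─ X)
        covers e kept′ with ∨-true {kept G S e} (trans (sym (not-lookup-─ S X e)) kept′)
        ... | inj₁ kept-e = e , kept-e , refl , refl
        ... | inj₂ e∈X    = proj₁ (shadowed (lookup⇒[]= e X e∈X))
        covers′ : Covers G (S ─ X) S
        covers′ e kept-e =
          e , trans (not-lookup-─ S X e) (cong (_∨ lookup X e) kept-e) , refl , refl

      countB-─ : ∀ (h g : Fin m → Bool) → (∀ e → lookup X e ≡ true → h e ≡ g e) →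
                 countB (λ e → kept G (S ─ X) e ∧ h e)
                 ≡ countB (λ e → kept G S e ∧ h e) + countB (λ e → lookup X e ∧ g e)
      countB-─ h g h≡g = trans (countB-cong split) (countB-∨ _ _ disjoint)
        where
        split : ∀ e → kept G (S ─ X) e ∧ h e ≡ (kept G S e ∧ h e) ∨ (lookup X e ∧ g e)
        split e rewrite not-lookup-─ S X e with lookup X e in e∈X
        ... | true  rewrite X-deleted e∈X = h≡g e e∈X
        ... | false = trans (cong (_∧ h e) (∨-identityʳ (kept G S e))) (sym (∨-identityʳ _))
        disjoint : ∀ e → (kept G S e ∧ h e) ∧ (lookup X e ∧ g e) ≡ false
        disjoint e with lookup X e in e∈X
        ... | true  rewrite X-deleted e∈X = refl
        ... | false = ∧-zeroʳ _

    outdegSCC-─ : ∀ x → outdegSCC G (S ─ X) x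
                        ≡ outdegSCC G S x + countB (λ e → lookup X e ∧ ⌊ src G e ≟ x ⌋)
    outdegSCC-─ x = trans (countB-cong (λ e → cong (λ b → kept G (S ─ X) e ∧ ⌊ src G e ≟ x ⌋ ∧ b)
                                                   (sameSCC-─ x (tgt G e))))
                          (countB-─ _ _ within)
      where
      within : ∀ e → lookup X e ≡ true →
               ⌊ src G e ≟ x ⌋ ∧ sameSCC G S x (tgt G e) ≡ ⌊ src G e ≟ x ⌋
      within e e∈X with src G e ≟ x
      ... | yes refl = X-within-SCC e∈X
      ... | no  _    = refl

    indegSCC-─ : ∀ x → indegSCC G (S ─ X) x
                       ≡ indegSCC G S x + countB (λ e → lookup X e ∧ ⌊ tgt G e ≟ x ⌋)
    indegSCC-─ x = trans (countB-cong (λ e → cong (λ b → kept G (S ─ X) e ∧ ⌊ tgt G e ≟ x ⌋ ∧ b)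
                                                  (sameSCC-─ (src G e) x)))
                         (countB-─ _ _ within)
      where
      within : ∀ e → lookup X e ≡ true →
               ⌊ tgt G e ≟ x ⌋ ∧ sameSCC G S (src G e) x ≡ ⌊ tgt G e ≟ x ⌋
      within e e∈X with tgt G e ≟ x
      ... | yes refl = X-within-SCC e∈X
      ... | no  _    = refl

    -- Shadowed arcs change no reachability and stay inside SCCs of G − S, so putting them back
    -- only adds their own degrees, which cancel because X is balanced.
    ─-Eulerian : AllSCCsEulerian G S → Balanced X → AllSCCsEulerian G (S ─ X)
    ─-Eulerian eulerian balanced x = begin
      outdegSCC G (S ─ X) x
        ≡⟨ outdegSCC-─ x ⟩
      outdegSCC G S x + countB (λ e → lookup X e ∧ ⌊ src G e ≟ x ⌋)
        ≡⟨ cong₂ _+_ (eulerian x) (balanced x) ⟩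
      indegSCC G S x + countB (λ e → lookup X e ∧ ⌊ tgt G e ≟ x ⌋)
        ≡⟨ indegSCC-─ x ⟨
      indegSCC G (S ─ X) x ∎
      where open ≡-Reasoning

∈⁅⁆∪⁅⁆⁻ : ∀ {m} {a b e : Fin m} → e ∈ ⁅ a ⁆ ∪ ⁅ b ⁆ → e ≡ a ⊎ e ≡ b
∈⁅⁆∪⁅⁆⁻ {a = a} {b} e∈ with x∈p∪q⁻ ⁅ a ⁆ ⁅ b ⁆ e∈
... | inj₁ e∈⁅a⁆ = inj₁ (x∈⁅y⁆⇒x≡y a e∈⁅a⁆)
... | inj₂ e∈⁅b⁆ = inj₂ (x∈⁅y⁆⇒x≡y b e∈⁅b⁆)

module _ {n m : ℕ} {G : Multidigraph n m} {b : ℕ} {S : Subset m} where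

  digon-removable : IsSolution G b S → ∀ {e₀ e₁} → e₀ ∈ S → e₁ ∈ S → e₀ ≢ e₁ →
                    src G e₁ ≡ tgt G e₀ → tgt G e₁ ≡ src G e₀ →
                    KeptArc G S (src G e₀) (tgt G e₀) → KeptArc G S (tgt G e₀) (src G e₀) →
                    IsSolution G b (S ─ (⁅ e₀ ⁆ ∪ ⁅ e₁ ⁆))
  digon-removable (∣S∣≤b , eulerian) {e₀} {e₁} e₀∈S e₁∈S e₀≢e₁ src₁ tgt₁ forward backward =
    ≤-trans (∣p─q∣≤∣p∣ S X) ∣S∣≤b , ─-Eulerian G X⊆S shadowed eulerian balanced
    where
    X = ⁅ e₀ ⁆ ∪ ⁅ e₁ ⁆

    X⊆S : X ⊆ S
    X⊆S e∈X with ∈⁅⁆∪⁅⁆⁻ e∈X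
    ... | inj₁ refl = e₀∈S
    ... | inj₂ refl = e₁∈S

    shadowed : Shadowed G S X
    shadowed e∈X with ∈⁅⁆∪⁅⁆⁻ e∈X
    ... | inj₁ refl = forward , backward
    ... | inj₂ refl rewrite src₁ | tgt₁ = backward , forward

    balanced : Balanced G X
    balanced x = begin
      countB (λ e → lookup X e ∧ ⌊ src G e ≟ x ⌋)
        ≡⟨ countB-⁅⁆∪⁅⁆∧ e₀≢e₁ _ ⟩
      indicator ⌊ src G e₀ ≟ x ⌋ + indicator ⌊ src G e₁ ≟ x ⌋
        ≡⟨ +-comm (indicator ⌊ src G e₀ ≟ x ⌋) _ ⟩
      indicator ⌊ src G e₁ ≟ x ⌋ + indicator ⌊ src G e₀ ≟ x ⌋
        ≡⟨ cong₂ (λ s t → indicator ⌊ s ≟ x ⌋ + indicator ⌊ t ≟ x ⌋) src₁ (sym tgt₁) ⟩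
      indicator ⌊ tgt G e₀ ≟ x ⌋ + indicator ⌊ tgt G e₁ ≟ x ⌋
        ≡⟨ countB-⁅⁆∪⁅⁆∧ e₀≢e₁ _ ⟨
      countB (λ e → lookup X e ∧ ⌊ tgt G e ≟ x ⌋) ∎
      where open ≡-Reasoning

  deleted-partner : ∀ {x y} → deletedArcs G S x y ≡ deletedArcs G S y x →
                    ∀ {e} → e ∈ S → src G e ≡ x → tgt G e ≡ y →
                    ∃ λ e′ → e′ ∈ S × src G e′ ≡ y × tgt G e′ ≡ x
  deleted-partner {x} {y} balanced {e} e∈S src≡x tgt≡y
    with countB-witness _ (subst (0 <_) balanced
                                 (countB-pos (λ e → isArc G x y e ∧ lookup S e)
                                             (cong₂ _∧_ (isArc-intro G e src≡x tgt≡y) ([]=⇒lookup e∈S))))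
  ... | e′ , deleted′ with ∧-true deleted′
  ...   | isArc-e′ , e′∈S = e′ , lookup⇒[]= e′ S e′∈S , isArc-true G isArc-e′

  minimal-deletes-no-arc : IsMinimalSolution G b S → ∀ {x y} →
                           KeptArc G S x y → KeptArc G S y x →
                           deletedArcs G S x y ≡ deletedArcs G S y x →
                           ∀ {e} → src G e ≡ x → tgt G e ≡ y → e ∉ S
  minimal-deletes-no-arc (solution , minimal) forward backward balanced {e} refl refl e∈S
    with deleted-partner balanced e∈S refl refl
  ... | e′ , e′∈S , src′ , tgt′ =
    minimal (S ─ (⁅ e ⁆ ∪ ⁅ e′ ⁆))
            (p∩q≢∅⇒p─q⊂p S _ (e , x∈p∩q⁺ (e∈S , x∈p∪q⁺ (inj₁ (x∈⁅x⁆ e)))))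
            (digon-removable solution e∈S e′∈S e≢e′ src′ tgt′ forward backward)
    where
    e≢e′ : e ≢ e′
    e≢e′ refl = loopless G e src′

-- The imbalance gadget

module Gadget {n m : ℕ} (G : Multidigraph n m) {b c : ℕ} (w : Fin (suc (suc b)) → Fin n)
  (w-injective : Injective _≡_ _≡_ w)
  (arc-counts : ∀ (k : Fin (suc b)) → arcCount G (w (inject₁ k)) (w (suc k)) ≡ b + 1 + c
                                    × arcCount G (w (suc k)) (w (inject₁ k)) ≡ b + 1)
  (internal-arcs : ∀ e j → Internal G b w j → (src G e ≡ w j ⊎ tgt G e ≡ w j) →
                   IsGadgetArc G b w e)
  {S : Subset m} (solution : IsSolution G b S) where

  -- Pair k joins left k = w k and right k = w (k + 1); for i : Fin b the inner vertex
  -- w (i + 1) = right (inject₁ i) = left (suc i) lies between pairs inject₁ i and suc i.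
  left right : Fin (suc b) → Fin n
  left  k = w (inject₁ k)
  right k = w (suc k)

  forward-deleted backward-deleted : Fin (suc b) → ℕ
  forward-deleted  k = deletedArcs G S (left k) (right k)
  backward-deleted k = deletedArcs G S (right k) (left k)

  forward-split : ∀ k → forward-deleted k + keptArcs G S (left k) (right k) ≡ b + 1 + c
  forward-split k = trans (deleted+kept≡arcCount G S _ _) (proj₁ (arc-counts k))

  backward-split : ∀ k → backward-deleted k + keptArcs G S (right k) (left k) ≡ b + 1
  backward-split k = trans (deleted+kept≡arcCount G S _ _) (proj₂ (arc-counts k))

  ∣S∣<b+1 : ∣ S ∣ < b + 1
  ∣S∣<b+1 = ≤-<-trans (proj₁ solution) (m<m+n b z<s)

  forward-kept : ∀ k → KeptArc G S (left k) (right k)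
  forward-kept k = ∣S∣<arcCount⇒KeptArc G S
    (subst (∣ S ∣ <_) (sym (proj₁ (arc-counts k))) (<-≤-trans ∣S∣<b+1 (m≤m+n (b + 1) c)))

  backward-kept : ∀ k → KeptArc G S (right k) (left k)
  backward-kept k = ∣S∣<arcCount⇒KeptArc G S
    (subst (∣ S ∣ <_) (sym (proj₂ (arc-counts k))) ∣S∣<b+1)

  internal : ∀ (i : Fin b) → Internal G b w (suc (inject₁ i))
  internal i = z<s , subst (_< b) (sym (toℕ-inject₁ i)) (toℕ<n i)

  out-neighbours : ∀ i e → src G e ≡ right (inject₁ i) →
                   tgt G e ≡ left (inject₁ i) ⊎ tgt G e ≡ right (suc i)
  out-neighbours i e src≡ with internal-arcs e _ (internal i) (inj₁ src≡)
  ... | k , inj₁ (src≡left , tgt≡right)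
    with inject₁-injective {j = suc i} (w-injective (trans (sym src≡left) src≡))
  ...   | refl = inj₂ tgt≡right
  out-neighbours i e src≡ | k , inj₂ (src≡right , tgt≡left)
    with suc-injective (w-injective (trans (sym src≡right) src≡))
  ...   | refl = inj₁ tgt≡left

  in-neighbours : ∀ i e → tgt G e ≡ right (inject₁ i) →
                  src G e ≡ left (inject₁ i) ⊎ src G e ≡ right (suc i)
  in-neighbours i e tgt≡ with internal-arcs e _ (internal i) (inj₂ tgt≡)
  ... | k , inj₁ (src≡left , tgt≡right)
    with suc-injective (w-injective (trans (sym tgt≡right) tgt≡))
  ...   | refl = inj₁ src≡left
  in-neighbours i e tgt≡ | k , inj₂ (src≡right , tgt≡left)
    with inject₁-injective {j = suc i} (w-injective (trans (sym tgt≡left) tgt≡))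
  ...   | refl = inj₂ src≡right

  neighbours-distinct : ∀ (i : Fin b) → left (inject₁ i) ≢ right (suc i)
  neighbours-distinct i eq = m≢1+n+m (toℕ i)
    (trans (sym (trans (toℕ-inject₁ (inject₁ i)) (toℕ-inject₁ i))) (cong toℕ (w-injective eq)))

  -- Flow conservation at the inner vertex between pairs inject₁ i and suc i.
  constant-difference : ConstantDifference forward-deleted backward-deleted
  constant-difference i =
    balance-of-complements
      {k = keptArcs G S x y} {keptArcs G S x z} {keptArcs G S y x} {keptArcs G S z x}
      (backward-split (inject₁ i)) (forward-split (suc i))
      (forward-split (inject₁ i)) (backward-split (suc i))
      (kept-out≡kept-in G S (neighbours-distinct i)
        (keptArcs⇒sameSCC G S (backward-kept (inject₁ i)) (forward-kept (inject₁ i)))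
        (keptArcs⇒sameSCC G S (forward-kept (suc i)) (backward-kept (suc i)))
        (proj₂ solution) (out-neighbours i) (in-neighbours i))
    where
    x = right (inject₁ i)
    y = left (inject₁ i)
    z = right (suc i)

  InPair : Fin (suc b) → Fin m → Set
  InPair k e = (src G e ≡ left k × tgt G e ≡ right k)
             ⊎ (src G e ≡ right k × tgt G e ≡ left k)

  pair-unique : ∀ {e k k′} → InPair k e → InPair k′ e → k ≡ k′
  pair-unique (inj₁ (s , _)) (inj₁ (s′ , _)) = inject₁-injective (w-injective (trans (sym s) s′))
  pair-unique (inj₂ (s , _)) (inj₂ (s′ , _)) = suc-injective (w-injective (trans (sym s) s′))
  pair-unique (inj₁ (s , t)) (inj₂ (s′ , t′)) =
    ⊥-elim (no-crossing (w-injective (trans (sym s) s′)) (w-injective (trans (sym t) t′)))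
  pair-unique (inj₂ (s , t)) (inj₁ (s′ , t′)) =
    ⊥-elim (no-crossing (w-injective (trans (sym s′) s)) (w-injective (trans (sym t′) t)))

  onPair : Fin (suc b) → Fin m → Bool
  onPair k e = isArc G (left k) (right k) e ∨ isArc G (right k) (left k) e

  onPair⇒InPair : ∀ {k e} → onPair k e ≡ true → InPair k e
  onPair⇒InPair {k} {e} on with ∨-true {isArc G (left k) (right k) e} on
  ... | inj₁ forward  = inj₁ (isArc-true G forward)
  ... | inj₂ backward = inj₂ (isArc-true G backward)

  pair-deleted : Fin (suc b) → Fin m → Bool
  pair-deleted k e = onPair k e ∧ lookup S e

  -- b deletions cannot reach all b + 1 pairs.
  intact-pair : ∃ λ k → countB (pair-deleted k) ≡ 0
  intact-pair = sum≤⇒∃≡0 b (countB ∘ pair-deleted) (begin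
    sum (countB ∘ pair-deleted)
      ≤⟨ sum-countB-≤ (suc b) pair-deleted (lookup S) (λ k e → proj₂ ∘ ∧-true {onPair k e})
           (λ _ _ _ p p′ → pair-unique (on p) (on p′)) ⟩
    countB (lookup S)  ≡⟨ ∣∣≡countB S ⟨
    ∣ S ∣              ≤⟨ proj₁ solution ⟩
    b                  ∎)
    where
    open ≤-Reasoning
    on : ∀ {k e} → pair-deleted k e ≡ true → InPair k e
    on {k} = onPair⇒InPair ∘ proj₁ ∘ ∧-true {onPair k _}

  deleted-balanced : ∀ k → forward-deleted k ≡ backward-deleted k
  deleted-balanced with intact-pair
  ... | k₀ , none = agree-everywhere forward-deleted backward-deleted constant-difference k₀
                      (trans (vanishes forward⊆) (sym (vanishes backward⊆)))
    where
    vanishes : ∀ {p} → (∀ e → p e ≡ true → pair-deleted k₀ e ≡ true) → countB p ≡ 0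
    vanishes p⊆ = n≤0⇒n≡0 (≤-trans (countB-mono p⊆) (≤-reflexive none))
    forward⊆ : ∀ e → isArc G (left k₀) (right k₀) e ∧ lookup S e ≡ true → pair-deleted k₀ e ≡ true
    forward⊆ e deleted with ∧-true {isArc G (left k₀) (right k₀) e} deleted
    ... | forward , e∈S = cong₂ _∧_ (cong (_∨ isArc G (right k₀) (left k₀) e) forward) e∈S
    backward⊆ : ∀ e → isArc G (right k₀) (left k₀) e ∧ lookup S e ≡ true → pair-deleted k₀ e ≡ true
    backward⊆ e deleted with ∧-true {isArc G (right k₀) (left k₀) e} deleted
    ... | backward , e∈S = cong₂ _∧_ (∨-trueʳ (isArc G (left k₀) (right k₀) e) backward) e∈S

lemma1 : ∀ {n m : ℕ} (G : Multidigraph n m) (b c : ℕ) → 0 < b → 0 < c →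
    (S : Subset m) → IsSolution G b S →
    (u v : Fin n) (w : Fin (suc (suc b)) → Fin n) → GadgetPresent G b c u v w →
    IsMinimalSolution G b S →
    ∀ (e : Fin m) → IsGadgetArc G b w e → e ∉ S
lemma1 G _ _ _ _ S solution _ _ w (w-injective , _ , _ , arc-counts , _ , internal-arcs)
       minimal e (k , ends) =
  [ (λ (src≡ , tgt≡) → minimal-deletes-no-arc minimal (forward-kept k) (backward-kept k)
                                               (deleted-balanced k) src≡ tgt≡)
  , (λ (src≡ , tgt≡) → minimal-deletes-no-arc minimal (backward-kept k) (forward-kept k)
                                               (sym (deleted-balanced k)) src≡ tgt≡)
  ] ends
  where open Gadget G w w-injective arc-counts internal-arcs {S} solution
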